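{- Let $P$ be a non-empty set and $\mathcal{L}$ a set of formulae with semantic function $[\![\cdot]\!]:\mathcal{L}\to\mathcal{P}(P)$ such that $\mathcal{L}(p)\neq\emptyset$ for every $p\in P$. For all $\phi,\psi\in\mathcal{L}$ and $p\in P$ such that a characteristic formula $\chi(p)$ for $p$ exists, $p\notin[\![\psi]\!]$ and $\phi$ is prime: if $[\![\phi]\!]=[\![\chi(p)]\!]\cup[\![\psi]\!]$, then $[\![\phi]\!]=[\![\chi(p)]\!]$.
   Context: For $p\in P$, $\mathcal{L}(p)=\{\phi\in\mathcal{L}\mid p\in[\![\phi]\!]\}$. A formula $\chi(p)$ is characteristic for $p$ iff for all $q\in P$: $q\in[\![\chi(p)]\!]$ iff $\mathcal{L}(p)\subseteq\mathcal{L}(q)$. A formula $\phi$ is prime iff for every non-empty finite $\Psi\subseteq\mathcal{L}$, $[\![\phi]\!]\subseteq\bigcup_{\psi\in\Psi}[\![\psi]\!]$ implies $[\![\phi]\!]\subseteq[\![\psi]\!]$ for some $\psi\in\Psi$. -}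

module Defs where

open import Level using (Level; _⊔_)
open import Data.List using (List; [])
open import Data.List.Relation.Unary.Any using (Any)
open import Data.List.Membership.Propositional using (_∈_)
open import Data.Product using (Σ; ∃; _×_)
open import Relation.Nullary using (¬_)
open import Relation.Binary.PropositionalEquality using (_≢_)

module _ {a b c : Level} {P : Set a} {L : Set b} (⟦_⟧ : L → P → Set c) where

  _⊆ₚ_ : (P → Set c) → (P → Set c) → Set (a ⊔ c)
  X ⊆ₚ Y = ∀ q → X q → Y q

  _≐ₚ_ : (P → Set c) → (P → Set c) → Set (a ⊔ c)
  X ≐ₚ Y = (X ⊆ₚ Y) × (Y ⊆ₚ X)

  _∪ₚ_ : (P → Set c) → (P → Set c) → (P → Set c)
  (X ∪ₚ Y) q = Data.Sum._⊎_ (X q) (Y q)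
    where import Data.Sum

  -- 𝓛(p) ⊆ 𝓛(q): every formula satisfied by p is satisfied by q
  LogicIncl : P → P → Set (b ⊔ c)
  LogicIncl p q = ∀ φ → ⟦ φ ⟧ p → ⟦ φ ⟧ q

  IsCharacteristic : L → P → Set (a ⊔ b ⊔ c)
  IsCharacteristic χ p = ∀ q → (⟦ χ ⟧ q → LogicIncl p q) × (LogicIncl p q → ⟦ χ ⟧ q)

  -- φ is prime: for every non-empty finite Ψ ⊆ 𝓛 (given as a non-empty list),
  -- ⟦φ⟧ ⊆ ⋃_{ψ∈Ψ} ⟦ψ⟧ implies ⟦φ⟧ ⊆ ⟦ψ⟧ for some ψ ∈ Ψ.
  IsPrime : L → Set (a ⊔ b ⊔ c)
  IsPrime φ = (Ψ : List L) → Ψ ≢ [] →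
    (∀ q → ⟦ φ ⟧ q → Any (λ ψ → ⟦ ψ ⟧ q) Ψ) →
    Σ L (λ ψ → (ψ ∈ Ψ) × (⟦ φ ⟧ ⊆ₚ ⟦ ψ ⟧))

{-# OPTIONS --safe #-}
module Submission where

open import Defs
open import Level using (Level)
open import Data.Product using (Σ; _,_; proj₂)
open import Data.Sum using (_⊎_; inj₁; inj₂; [_,_]′)
open import Data.List using ([]; _∷_)
open import Data.List.Relation.Unary.Any using (here; there)
open import Function using (_∘_)
open import Relation.Nullary using (¬_; contradiction)
open import Relation.Binary.PropositionalEquality using (refl)

module _ {a b c : Level} {P : Set a} {L : Set b} (⟦_⟧ : L → P → Set c) where

  characteristic⇒satisfied : ∀ {χ p} → IsCharacteristic ⟦_⟧ χ p → ⟦ χ ⟧ p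
  characteristic⇒satisfied {p = p} isχ = proj₂ (isχ p) (λ _ sat → sat)

  prime-⊆∪⇒⊆⊎⊆ : ∀ {φ χ ψ} → IsPrime ⟦_⟧ φ →
    _⊆ₚ_ ⟦_⟧ ⟦ φ ⟧ (_∪ₚ_ ⟦_⟧ ⟦ χ ⟧ ⟦ ψ ⟧) →
    _⊆ₚ_ ⟦_⟧ ⟦ φ ⟧ ⟦ χ ⟧ ⊎ _⊆ₚ_ ⟦_⟧ ⟦ φ ⟧ ⟦ ψ ⟧
  prime-⊆∪⇒⊆⊎⊆ {χ = χ} {ψ} prime φ⊆χ∪ψ
    with prime (χ ∷ ψ ∷ []) (λ ()) (λ q → [ here , there ∘ here ]′ ∘ φ⊆χ∪ψ q)
  ... | _ , here refl , φ⊆χ = inj₁ φ⊆χ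
  ... | _ , there (here refl) , φ⊆ψ = inj₂ φ⊆ψ
  ... | _ , there (there ()) , _

mainTheorem6 : {a b c : Level} (P : Set a) (L : Set b) (⟦_⟧ : L → P → Set c) →
    P →
    (∀ (p : P) → Σ L (λ φ → ⟦ φ ⟧ p)) →
    ∀ (φ ψ χ : L) (p : P) →
    IsCharacteristic ⟦_⟧ χ p →
    ¬ (⟦ ψ ⟧ p) →
    IsPrime ⟦_⟧ φ →
    _≐ₚ_ ⟦_⟧ ⟦ φ ⟧ (_∪ₚ_ ⟦_⟧ ⟦ χ ⟧ ⟦ ψ ⟧) →
    _≐ₚ_ ⟦_⟧ ⟦ φ ⟧ ⟦ χ ⟧
mainTheorem6 P L ⟦_⟧ _ _ φ ψ χ p isχ p∉ψ prime (φ⊆χ∪ψ , χ∪ψ⊆φ)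
  with prime-⊆∪⇒⊆⊎⊆ ⟦_⟧ prime φ⊆χ∪ψ
... | inj₁ φ⊆χ = φ⊆χ , χ⊆φ
  where
  χ⊆φ : _⊆ₚ_ ⟦_⟧ ⟦ χ ⟧ ⟦ φ ⟧
  χ⊆φ q = χ∪ψ⊆φ q ∘ inj₁
... | inj₂ φ⊆ψ = contradiction p∈ψ p∉ψ
  where
  p∈ψ : ⟦ ψ ⟧ p
  p∈ψ = φ⊆ψ p (χ∪ψ⊆φ p (inj₁ (characteristic⇒satisfied ⟦_⟧ isχ)))
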